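{- Let $\lambda/\mu$ be a skew shape with $r$ rows and $c$ columns, $n=r+c$, let $(I_1,\dots,I_n)$ be the Grassmann necklace of its rook matroid and $\rho_i$ the non-nesting rook placement corresponding to $I_i$. Then: (1) for every column index $j\in[r+2,r+c]$, $c_{r_j}\ge j-1$; (2) for every row index $i\in[1,r]$, $r_{c_i+2}-1\le i$; (3) if $(t_j,s_j)$ and $(t_{j+1},s_{j+1})$ are successive rooks of $\rho_i$ (consecutive when the rooks are ordered by increasing row index), then $t_{j+1}=t_j+1$ or $s_{j+1}=s_j-1$.
   Context: Rows of $\lambda/\mu$ are labelled $1,\dots,r$ top to bottom, columns $r+1,\dots,r+c$ left to right; the skew shape is the cell set $\{(i,r+j):1\le i\le r,\ \mu_i<j\le\lambda_i\}$, all rows and columns nonempty. The rook matroid is the matroid on $[n]$ with bases $R(\rho)\cup C(\rho)$ ($R$ = occupied rows, $C$ = unoccupied columns) over all non-nesting rook placements $\rho$ (no two rooks in a common row or column, no two $(i,j),(k,\ell)$ with $i<k$, $j<\ell$). Its Grassmann necklace: $I_i$ is the lexicographically smallest basis with respect to $i<i+1<\dots<n<1<\dots<i-1$; equivalently $I_i=R(\rho_i)\cup C(\rho_i)$ with $\rho_i$ the $i$-extremal non-nesting rook placement (for a row $i$: rook in the last cell of row $i$, then in rows $i+1,\dots,r$ successively place rooks as far right as possible keeping non-nesting, until reaching the last row or first column; for a column $i$: leave columns $i,\dots,r+c$ empty and in rows $1,\dots,r$ successively place rooks as far right as possible keeping those columns empty and the placement non-attacking, non-nesting). Notation: $R_i=I_i\cap[1,r]$,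 $r_i=\min R_i$ (for $i\neq r+1$), $r_i=0$ for $i\ge n+1$; $C_i=I_i\cap[r+1,n]$, $c_i=\max([r+1,n]\setminus C_i)$. -}

module Defs where

open import Data.Nat using (ℕ; zero; suc; _+_; _∸_; _≤_; _<_; _≤ᵇ_; _<ᵇ_; _≡ᵇ_; _⊓_; _⊔_)
open import Data.Bool using (Bool; true; false; _∧_; _∨_; not; if_then_else_)
open import Data.List using (List; []; _∷_; map; filterᵇ; upTo; _++_; foldr)
open import Data.Bool.ListAction using (any)
open import Data.List.Membership.Propositional using (_∈_)
open import Data.List.Relation.Unary.All using (All)
open import Data.List.Relation.Unary.AllPairs using (AllPairs)
open import Data.Product using (_×_; _,_; proj₁; proj₂; ∃; ∃-syntax)
open import Relation.Binary.PropositionalEquality using (_≡_; _≢_)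
open import Relation.Nullary using (¬_)

-- Rows are 1..r; the cells of row i are the columns j with μ i < j ≤ λ i
-- (j ∈ [1,c]); column j carries the label r + j.  Values of lam/mu outside
-- [1,r] are irrelevant.

record SkewShape (r c : ℕ) : Set where
  field
    lam mu : ℕ → ℕ
    lam-decr  : ∀ i → 1 ≤ i → i < r → lam (suc i) ≤ lam i
    mu-decr   : ∀ i → 1 ≤ i → i < r → mu (suc i) ≤ mu i
    row-nonempty : ∀ i → 1 ≤ i → i ≤ r → mu i < lam i
    lam-bound : ∀ i → 1 ≤ i → i ≤ r → lam i ≤ c
    col-nonempty : ∀ j → 1 ≤ j → j ≤ c →
      ∃[ i ] (1 ≤ i × i ≤ r × mu i < j × j ≤ lam i)

open SkewShape public

-- A cell is a pair (row label, column label), column labels in [r+1, r+c].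
Cell : Set
Cell = ℕ × ℕ

InShape : ∀ {r c} → SkewShape r c → Cell → Set
InShape {r} S (i , col) = 1 ≤ i × i ≤ r × mu S i + r < col × col ≤ lam S i + r

Compatible : Cell → Cell → Set
Compatible (i , j) (k , l) =
  i ≢ k × j ≢ l × ¬ (i < k × j < l) × ¬ (k < i × l < j)

NonNesting : ∀ {r c} → SkewShape r c → List Cell → Set
NonNesting S ρ = All (InShape S) ρ × AllPairs Compatible ρ

rowOcc : List Cell → ℕ → Bool
rowOcc ρ x = any (λ p → proj₁ p ≡ᵇ x) ρ

colOcc : List Cell → ℕ → Bool
colOcc ρ x = any (λ p → proj₂ p ≡ᵇ x) ρ

inBasis : (r c : ℕ) → List Cell → ℕ → Bool
inBasis r c ρ x =
  ((1 ≤ᵇ x) ∧ (x ≤ᵇ r) ∧ rowOcc ρ x) ∨ ((r <ᵇ x) ∧ (x ≤ᵇ r + c) ∧ not (colOcc ρ x))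

range : ℕ → ℕ → List ℕ
range a b = map (a +_) (upTo (suc b ∸ a))

rot : ℕ → ℕ → List ℕ
rot n i = range i n ++ range 1 (i ∸ 1)

key : (r c : ℕ) → ℕ → List Cell → List ℕ
key r c i ρ = filterᵇ (inBasis r c ρ) (rot (r + c) i)

rank : ℕ → ℕ → ℕ → ℕ
rank n i x = if i ≤ᵇ x then x ∸ i else x + n ∸ i

data LexLeq : List ℕ → List ℕ → Set where
  lex-[]   : ∀ {ys} → LexLeq [] ys
  lex-<    : ∀ {x y xs ys} → x < y → LexLeq (x ∷ xs) (y ∷ ys)
  lex-same : ∀ {x xs ys} → LexLeq xs ys → LexLeq (x ∷ xs) (x ∷ ys)

LexLeqAt : (r c : ℕ) → ℕ → List Cell → List Cell → Set
LexLeqAt r c i ρ σ =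
  LexLeq (map (rank (r + c) i) (key r c i ρ)) (map (rank (r + c) i) (key r c i σ))

-- ρ i (1 ≤ i ≤ n) is the non-nesting placement with R(ρ i) ∪ C(ρ i) = I_i,
-- I_i the lexicographically smallest basis of the rook matroid for ≺ᵢ.

IsNecklacePlacements : ∀ {r c} → SkewShape r c → (ℕ → List Cell) → Set
IsNecklacePlacements {r} {c} S ρ =
  ∀ i → 1 ≤ i → i ≤ r + c →
    NonNesting S (ρ i) × (∀ σ → NonNesting S σ → LexLeqAt r c i (ρ i) σ)

-- r_i = min R_i (r_i = 0 for i ≥ n+1),  c_i = max ([r+1,n] ∖ C_i)
-- = the largest occupied column of ρ_i.

minL : List ℕ → ℕ
minL []       = 0
minL (x ∷ xs) = foldr _⊓_ x xs

maxL : List ℕ → ℕ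
maxL = foldr _⊔_ 0

rIdx : (r c : ℕ) → (ℕ → List Cell) → ℕ → ℕ
rIdx r c ρ i = if r + c <ᵇ i then 0 else minL (map proj₁ (ρ i))

cIdx : (ℕ → List Cell) → ℕ → ℕ
cIdx ρ i = maxL (map proj₂ (ρ i))

{-# OPTIONS --safe #-}
module Submission where

-- Each ρ i is the non-nesting placement whose basis is lexicographically least for
-- i ≺ i+1 ≺ … ≺ n ≺ 1 ≺ … ≺ i-1.  Adding a rook, removing one, or sliding one along its
-- row or column exchanges a single element of the basis for another, so whenever such a
-- move keeps the placement non-nesting, the entering element cannot precede the leaving one.
--
-- For a row i this puts a rook of ρ i in the last cell of row i or further right.  For a
-- column j, a cell (w, j-1) of the shape could take a rook unless some rook of ρ j lies in
-- a row x ≤ w or in a column ≥ j-1; either way row x, and hence the topmost row r_j of ρ j,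
-- reaches column j-1.  This gives (1), and also (2): r_{c_i+2} reaches column c_i+1, past
-- the end of row i, so it lies above row i.
--
-- For (3), let (t,s), (t′,s′) be consecutive rooks with t′ > t+1 and s′ < s-1.  Unless
-- (t,s) can be removed, ≺ agrees with < on [t, s].  Column s-1 is not empty, so either
-- row t′ reaches it, and (t′,s′) slides right, or row t′-1 starts before it; then (t′,s′)
-- slides up to row t′-1, or a new rook fits in the first cell of row t′-1.

open import Defs
open import Data.Bool using (true; false; T)
open import Data.Bool.ListAction using (any)
open import Data.Bool.Properties using (T?)
open import Data.Empty using (⊥; ⊥-elim)
open import Data.List using (List; _∷_; map; filter)
open import Data.List.Membership.Propositional using (_∈_; find; lose)
import Data.List.Membership.Propositional.Properties as ∈
open import Data.List.Properties using (filter-accept; filter-reject; foldr-preservesᵒ)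
open import Data.List.Relation.Unary.All as All using (All; _∷_)
import Data.List.Relation.Unary.All.Properties as All
open import Data.List.Relation.Unary.AllPairs using (AllPairs; _∷_)
import Data.List.Relation.Unary.AllPairs.Properties as AllPairs
open import Data.List.Relation.Unary.Any as Any using (Any; here; there; any?)
import Data.List.Relation.Unary.Any.Properties as Any
open import Data.Nat using (ℕ; zero; suc; _+_; _∸_; _≤_; _<_; _≤ᵇ_; _<ᵇ_; _≡ᵇ_; z≤n; s≤s)
open import Data.Nat.Properties
open import Data.Product using (_×_; _,_; proj₁; proj₂; ∃-syntax; uncurry)
open import Data.Product.Properties using (≡-dec)
open import Data.Sum using (_⊎_; inj₁; inj₂; [_,_])
open import Function using (id; _∘_; _⇔_; mk⇔; Equivalence)
open Equivalence using (to; from)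
import Function.Properties.Equivalence as ⇔
open import Relation.Binary.Definitions using (DecidableEquality)
open import Relation.Binary.PropositionalEquality
  using (_≡_; _≢_; refl; sym; trans; cong; subst; ≢-sym)
open import Relation.Nullary using (¬_; ¬?; yes; no; contradiction)
open import Relation.Nullary.Decidable using (_⊎-dec_; decidable-stable)
open import Relation.Nullary.Reflects
  using (Reflects; ofʸ; ofⁿ; fromEquivalence; _×-reflects_; _⊎-reflects_; ¬-reflects)
open import Relation.Unary using (Decidable)

LexLeq-tail : ∀ {x xs ys} → LexLeq (x ∷ xs) (x ∷ ys) → LexLeq xs ys
LexLeq-tail (lex-< x<x) = contradiction x<x (<-irrefl refl)
LexLeq-tail (lex-same xs≤ys) = xs≤ys

¬LexLeq-below : ∀ {a b bs ys} → All (a <_) bs → b ∈ bs → ¬ LexLeq bs (a ∷ ys)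
¬LexLeq-below (a<b ∷ _) _ (lex-< b<a) = <-asym a<b b<a
¬LexLeq-below (a<a ∷ _) _ (lex-same _) = <-irrefl refl a<a

module _ {A : Set} (rk : A → ℕ) {P Q : A → Set} (P? : Decidable P) (Q? : Decidable Q) where

  LexLeq-filter-∷⁻ : ∀ {a xs ys} → (P a ⇔ Q a) →
    LexLeq (map rk (filter P? (a ∷ xs))) (map rk (filter Q? (a ∷ ys))) →
    LexLeq (map rk (filter P? xs)) (map rk (filter Q? ys))
  LexLeq-filter-∷⁻ {a} pa⇔qa with P? a | Q? a
  ... | yes _  | yes _  = LexLeq-tail
  ... | no _   | no _   = λ lex → lex
  ... | yes pa | no ¬qa = contradiction (to pa⇔qa pa) ¬qa
  ... | no ¬pa | yes qa = contradiction (from pa⇔qa qa) ¬pa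

  filter-exchange-¬LexLeq : ∀ {L x y} → AllPairs (λ a b → rk a < rk b) L →
    x ∈ L → y ∈ L → rk y < rk x → P x → ¬ P y → Q y →
    (∀ z → z ≢ x → z ≢ y → P z ⇔ Q z) →
    ¬ LexLeq (map rk (filter P? L)) (map rk (filter Q? L))
  filter-exchange-¬LexLeq _ (here refl) (here refl) y<x _ _ _ _ _ = <-irrefl refl y<x
  filter-exchange-¬LexLeq (x<L ∷ _) (here refl) (there y∈L) y<x _ _ _ _ _ =
    <-asym y<x (All.lookup x<L y∈L)
  filter-exchange-¬LexLeq {y ∷ L} (y<L ∷ _) (there x∈L) (here refl) _ px ¬py qy _ lex
    rewrite filter-reject P? {xs = L} ¬py | filter-accept Q? {xs = L} qy =
    ¬LexLeq-below (All.map⁺ (All.filter⁺ P? y<L)) (∈.∈-map⁺ rk (∈.∈-filter⁺ P? x∈L px)) lex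
  filter-exchange-¬LexLeq {a ∷ L} (a<L ∷ sorted) (there x∈L) (there y∈L) y<x px ¬py qy agree =
    filter-exchange-¬LexLeq sorted x∈L y∈L y<x px ¬py qy agree ∘ LexLeq-filter-∷⁻ pa⇔qa
    where
    pa⇔qa : P a ⇔ Q a
    pa⇔qa = agree a (λ { refl → <-irrefl refl (All.lookup a<L x∈L) })
                    (λ { refl → <-irrefl refl (All.lookup a<L y∈L) })

module Rotation (n i : ℕ) where

  _≺_ : ℕ → ℕ → Set
  x ≺ y = rank n i x < rank n i y

  rank-≥ : ∀ {x} → i ≤ x → rank n i x ≡ x ∸ i
  rank-≥ {x} i≤x with i ≤ᵇ x | ≤ᵇ-reflects-≤ i x
  ... | true  | _        = refl
  ... | false | ofⁿ i≰x = contradiction i≤x i≰x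

  rank-< : ∀ {x} → x < i → rank n i x ≡ x + n ∸ i
  rank-< {x} x<i with i ≤ᵇ x | ≤ᵇ-reflects-≤ i x
  ... | true  | ofʸ i≤x = contradiction i≤x (<⇒≱ x<i)
  ... | false | _        = refl

  <⇒≺-≥i : ∀ {x y} → i ≤ x → x < y → x ≺ y
  <⇒≺-≥i i≤x x<y rewrite rank-≥ i≤x | rank-≥ (≤-trans i≤x (<⇒≤ x<y)) =
    ∸-monoˡ-< x<y i≤x

  <⇒≺-<i : i ≤ n → ∀ {x y} → x < y → y < i → x ≺ y
  <⇒≺-<i i≤n {x} x<y y<i rewrite rank-< (<-trans x<y y<i) | rank-< y<i =
    ∸-monoˡ-< (+-monoˡ-< n x<y) (≤-trans i≤n (m≤n+m n x))

  ≺-wrap : ∀ {x y} → i ≤ x → x ≤ n → 1 ≤ y → y < i → x ≺ y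
  ≺-wrap i≤x x≤n 1≤y y<i rewrite rank-≥ i≤x | rank-< y<i =
    ≤-<-trans (∸-monoˡ-≤ i x≤n) (∸-monoˡ-< (+-monoˡ-≤ n 1≤y) (≤-trans i≤x x≤n))

  rot-sorted : 1 ≤ i → i ≤ n → AllPairs _≺_ (rot n i)
  rot-sorted 1≤i i≤n = AllPairs.++⁺
    (AllPairs.map⁺ (AllPairs.applyUpTo⁺₁ id (suc n ∸ i) λ a<b _ →
      <⇒≺-≥i (m≤m+n i _) (+-monoʳ-< i a<b)))
    (AllPairs.map⁺ (AllPairs.applyUpTo⁺₁ id (i ∸ 1) λ a<b b<i-1 →
      <⇒≺-<i i≤n (s≤s a<b) (1+-below-i b<i-1)))
    (All.map⁺ (All.applyUpTo⁺₁ id (suc n ∸ i) λ a<n+1-i →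
      All.map⁺ (All.applyUpTo⁺₁ id (i ∸ 1) λ b<i-1 →
        ≺-wrap (m≤m+n i _) (i+-upto-n a<n+1-i) (s≤s z≤n) (1+-below-i b<i-1))))
    where
    1+-below-i : ∀ {b} → b < i ∸ 1 → 1 + b < i
    1+-below-i {b} b<i-1 = subst (2 + b ≤_) (m+[n∸m]≡n 1≤i) (s≤s b<i-1)
    i+-upto-n : ∀ {a} → a < suc n ∸ i → i + a ≤ n
    i+-upto-n {a} a<n+1-i =
      ≤-pred (subst (i + a <_) (m+[n∸m]≡n (≤-trans i≤n (n≤1+n n))) (+-monoʳ-< i a<n+1-i))

∈-range : ∀ {a b z} → a ≤ z → z ≤ b → z ∈ range a b
∈-range a≤z z≤b =
  Any.map⁺ (Any.applyUpTo⁺ id (sym (m+[n∸m]≡n a≤z)) (∸-monoˡ-< (s≤s z≤b) a≤z))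

∈-rot : ∀ {n} i {x} → 1 ≤ x → x ≤ n → x ∈ rot n i
∈-rot {n} i {x} 1≤x x≤n with i ≤? x
... | yes i≤x = Any.++⁺ˡ (∈-range i≤x x≤n)
... | no  i≰x = Any.++⁺ʳ (range i n) (∈-range 1≤x (∸-monoˡ-≤ 1 (≰⇒> i≰x)))

T⇔-reflected : ∀ {A : Set} {b} → Reflects A b → T b ⇔ A
T⇔-reflected (ofʸ a)  = mk⇔ (λ _ → a) (λ _ → _)
T⇔-reflected (ofⁿ ¬a) = mk⇔ (λ ()) ¬a

Occupied : (Cell → ℕ) → List Cell → ℕ → Set
Occupied f ρ z = Any (λ p → f p ≡ z) ρ

occupied-reflects : ∀ f ρ z → Reflects (Occupied f ρ z) (any (λ p → f p ≡ᵇ z) ρ)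
occupied-reflects f ρ z =
  fromEquivalence (Any.map (≡ᵇ⇒≡ _ _) ∘ Any.any⁻ _ ρ) (Any.any⁺ _ ∘ Any.map (≡⇒≡ᵇ _ _))

InBasis : ℕ → ℕ → List Cell → ℕ → Set
InBasis r c ρ x =
  (1 ≤ x × x ≤ r × Occupied proj₁ ρ x) ⊎ (r < x × x ≤ r + c × ¬ Occupied proj₂ ρ x)

T-inBasis : ∀ r c ρ x → T (inBasis r c ρ x) ⇔ InBasis r c ρ x
T-inBasis r c ρ x = T⇔-reflected
  ((≤ᵇ-reflects-≤ 1 x ×-reflects ≤ᵇ-reflects-≤ x r ×-reflects occupied-reflects proj₁ ρ x)
  ⊎-reflects
  (<ᵇ-reflects-< r x ×-reflects ≤ᵇ-reflects-≤ x (r + c) ×-reflects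
     ¬-reflects (occupied-reflects proj₂ ρ x)))

InBasis⇒label : ∀ {r c ρ x} → InBasis r c ρ x → 1 ≤ x × x ≤ r + c
InBasis⇒label {r} (inj₁ (1≤x , x≤r , _)) = 1≤x , ≤-trans x≤r (m≤m+n r _)
InBasis⇒label     (inj₂ (r<x , x≤n , _)) = ≤-trans (s≤s z≤n) r<x , x≤n

¬LexLeqAt-exchange : ∀ {r c i ρ σ x y} → 1 ≤ i → i ≤ r + c →
  Rotation._≺_ (r + c) i y x →
  InBasis r c ρ x → ¬ InBasis r c ρ y → InBasis r c σ y →
  (∀ z → z ≢ x → z ≢ y → InBasis r c ρ z ⇔ InBasis r c σ z) →
  ¬ LexLeqAt r c i ρ σ
¬LexLeqAt-exchange {r} {c} {i} {ρ} {σ} {x} {y} 1≤i i≤n y≺x ρx ¬ρy σy agree =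
  filter-exchange-¬LexLeq (rank (r + c) i) (T? ∘ inBasis r c ρ) (T? ∘ inBasis r c σ)
    (Rotation.rot-sorted (r + c) i 1≤i i≤n) (∈-rot′ ρx) (∈-rot′ σy) y≺x
    (from (T-inBasis r c ρ x) ρx) (¬ρy ∘ to (T-inBasis r c ρ y)) (from (T-inBasis r c σ y) σy)
    λ z z≢x z≢y →
      ⇔.trans (T-inBasis r c ρ z) (⇔.trans (agree z z≢x z≢y) (⇔.sym (T-inBasis r c σ z)))
  where
  ∈-rot′ : ∀ {τ z} → InBasis r c τ z → z ∈ rot (r + c) i
  ∈-rot′ = uncurry (∈-rot i) ∘ InBasis⇒label

Compatible-sym : ∀ {p q} → Compatible p q → Compatible q p
Compatible-sym (i≢k , j≢l , ¬ij<kl , ¬kl<ij) = ≢-sym i≢k , ≢-sym j≢l , ¬kl<ij , ¬ij<kl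

Compatible-antidiagonal : ∀ {a b x y} → a < x → y < b → Compatible (a , b) (x , y)
Compatible-antidiagonal a<x y<b =
  <⇒≢ a<x , ≢-sym (<⇒≢ y<b) , (λ (_ , b<y) → <-asym y<b b<y) , (λ (x<a , _) → <-asym a<x x<a)

Compatible⇒antidiagonal : ∀ {t s t′ s′} → Compatible (t , s) (t′ , s′) → t < t′ → s′ < s
Compatible⇒antidiagonal (_ , s≢s′ , ¬nested , _) t<t′ =
  ≤∧≢⇒< (≮⇒≥ (λ s<s′ → ¬nested (t<t′ , s<s′))) (≢-sym s≢s′)

AllPairs-∈ : ∀ {A : Set} {R : A → A → Set} {xs x y} → AllPairs R xs →
  x ∈ xs → y ∈ xs → x ≢ y → R x y ⊎ R y x
AllPairs-∈ _            (here refl) (here refl) x≢y = contradiction refl x≢y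
AllPairs-∈ (Rx ∷ _)     (here refl) (there y∈)  _   = inj₁ (All.lookup Rx y∈)
AllPairs-∈ (Ry ∷ _)     (there x∈)  (here refl) _   = inj₂ (All.lookup Ry x∈)
AllPairs-∈ (_ ∷ Rxs)    (there x∈)  (there y∈)  x≢y = AllPairs-∈ Rxs x∈ y∈ x≢y

compatible-∈ : ∀ {ρ p q} → AllPairs Compatible ρ → p ∈ ρ → q ∈ ρ → p ≢ q → Compatible p q
compatible-∈ ρ-compatible p∈ρ q∈ρ p≢q =
  [ id , Compatible-sym ] (AllPairs-∈ ρ-compatible p∈ρ q∈ρ p≢q)

_≟ᶜ_ : DecidableEquality Cell
_≟ᶜ_ = ≡-dec _≟_ _≟_

delete : Cell → List Cell → List Cell
delete p = filter (λ q → ¬? (q ≟ᶜ p))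

∈-delete⁻ : ∀ {p q ρ} → q ∈ delete p ρ → q ∈ ρ × q ≢ p
∈-delete⁻ = ∈.∈-filter⁻ _

∈-delete⁺ : ∀ {p q ρ} → q ∈ ρ → q ≢ p → q ∈ delete p ρ
∈-delete⁺ = ∈.∈-filter⁺ _

compatible-with-others : ∀ {ρ p} → AllPairs Compatible ρ → p ∈ ρ → All (Compatible p) (delete p ρ)
compatible-with-others ρ-compatible p∈ρ = All.tabulate λ q∈ →
  let q∈ρ , q≢p = ∈-delete⁻ q∈ in compatible-∈ ρ-compatible p∈ρ q∈ρ (≢-sym q≢p)

Occupied-∷ : ∀ {f p ρ z} → f p ≢ z → Occupied f ρ z ⇔ Occupied f (p ∷ ρ) z
Occupied-∷ fp≢z = mk⇔ there λ { (here fp≡z) → contradiction fp≡z fp≢z ; (there occ) → occ }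

Occupied-delete : ∀ {f p ρ z} → f p ≢ z → Occupied f ρ z ⇔ Occupied f (delete p ρ) z
Occupied-delete {f} {p} {ρ} {z} fp≢z = mk⇔ keep (Any.filter⁻ _)
  where
  keep : Occupied f ρ z → Occupied f (delete p ρ) z
  keep occ = let q , q∈ρ , fq≡z = find occ in
    lose (∈-delete⁺ q∈ρ λ { refl → fp≢z fq≡z }) fq≡z

Occupied-replace : ∀ {f p p′ ρ z} → p ∈ ρ → (f p ≡ z ⇔ f p′ ≡ z) →
  Occupied f ρ z ⇔ Occupied f (p′ ∷ delete p ρ) z
Occupied-replace {f} {p} {p′} {ρ} {z} p∈ρ same = mk⇔ keep drop
  where
  keep : Occupied f ρ z → Occupied f (p′ ∷ delete p ρ) z
  keep occ with find occ
  ... | q , q∈ρ , fq≡z with q ≟ᶜ p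
  ...   | yes refl = here (to same fq≡z)
  ...   | no q≢p   = there (lose (∈-delete⁺ q∈ρ q≢p) fq≡z)
  drop : Occupied f (p′ ∷ delete p ρ) z → Occupied f ρ z
  drop (here fp′≡z) = lose p∈ρ (from same fp′≡z)
  drop (there occ)  = Any.filter⁻ _ occ

row-free : ∀ {a b ρ} → All (Compatible (a , b)) ρ → ¬ Occupied proj₁ ρ a
row-free compat = All.All¬⇒¬Any (All.map (λ (a≢k , _) → ≢-sym a≢k) compat)

col-free : ∀ {a b ρ} → All (Compatible (a , b)) ρ → ¬ Occupied proj₂ ρ b
col-free compat = All.All¬⇒¬Any (All.map (λ (_ , b≢l , _) → ≢-sym b≢l) compat)

InBasis-cong : ∀ {r c ρ σ z} →
  (Occupied proj₁ ρ z ⇔ Occupied proj₁ σ z) → (Occupied proj₂ ρ z ⇔ Occupied proj₂ σ z) →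
  InBasis r c ρ z ⇔ InBasis r c σ z
InBasis-cong rows cols = mk⇔
  [ (λ (1≤z , z≤r , occ) → inj₁ (1≤z , z≤r , to rows occ)) ,
    (λ (r<z , z≤r+c , free) → inj₂ (r<z , z≤r+c , free ∘ from cols)) ]
  [ (λ (1≤z , z≤r , occ) → inj₁ (1≤z , z≤r , from rows occ)) ,
    (λ (r<z , z≤r+c , free) → inj₂ (r<z , z≤r+c , free ∘ to cols)) ]

⇔-absurd : ∀ {A B : Set} → ¬ A → ¬ B → A ⇔ B
⇔-absurd ¬a ¬b = mk⇔ (λ a → contradiction a ¬a) (λ b → contradiction b ¬b)

minL-∈ : ∀ {z xs} → z ∈ xs → minL xs ∈ xs
minL-∈ {xs = x ∷ xs} _ with ∈.foldr-selective ⊓-sel x xs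
... | inj₁ min≡x   = here min≡x
... | inj₂ min∈xs = there min∈xs

minL-≤ : ∀ {z xs} → z ∈ xs → minL xs ≤ z
minL-≤ {z} {x ∷ xs} z∈ = foldr-preservesᵒ (λ a b → [ m≤n⇒m⊓o≤n b , m≤n⇒o⊓m≤n a ]) x xs (bound z∈)
  where
  bound : z ∈ x ∷ xs → x ≤ z ⊎ Any (_≤ z) xs
  bound (here refl) = inj₁ ≤-refl
  bound (there z∈xs) = inj₂ (lose z∈xs ≤-refl)

maxL-≥ : ∀ {v xs} → Any (v ≤_) xs → v ≤ maxL xs
maxL-≥ = foldr-preservesᵒ (λ a b → [ m≤n⇒m≤n⊔o b , m≤n⇒m≤o⊔n a ]) 0 _ ∘ inj₂

antitone-on : ∀ {r} (f : ℕ → ℕ) → (∀ i → 1 ≤ i → i < r → f (suc i) ≤ f i) →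
  ∀ {a b} → 1 ≤ a → a ≤ b → b ≤ r → f b ≤ f a
antitone-on f step {b = zero} 1≤a a≤0 _ = contradiction (≤-trans 1≤a a≤0) λ ()
antitone-on f step {a} {suc b} 1≤a a≤1+b 1+b≤r with m≤n⇒m<n∨m≡n a≤1+b
... | inj₂ refl      = ≤-refl
... | inj₁ (s≤s a≤b) =
  ≤-trans (step b (≤-trans 1≤a a≤b) 1+b≤r) (antitone-on f step 1≤a a≤b (<⇒≤ 1+b≤r))

module Shape {r c : ℕ} (S : SkewShape r c) where

  lam-antitone : ∀ {a b} → 1 ≤ a → a ≤ b → b ≤ r → lam S b ≤ lam S a
  lam-antitone = antitone-on (lam S) (lam-decr S)

  mu-antitone : ∀ {a b} → 1 ≤ a → a ≤ b → b ≤ r → mu S b ≤ mu S a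
  mu-antitone = antitone-on (mu S) (mu-decr S)

  InShape⇒r<col : ∀ {u v} → InShape S (u , v) → r < v
  InShape⇒r<col {u} (_ , _ , mu+r<v , _) = ≤-<-trans (m≤n+m r (mu S u)) mu+r<v

  InShape⇒col≤n : ∀ {u v} → InShape S (u , v) → v ≤ r + c
  InShape⇒col≤n {u} (1≤u , u≤r , _ , v≤lam+r) =
    ≤-trans v≤lam+r (subst (lam S u + r ≤_) (+-comm c r) (+-monoˡ-≤ r (lam-bound S u 1≤u u≤r)))

  last-cell : ∀ {u} → 1 ≤ u → u ≤ r → InShape S (u , lam S u + r)
  last-cell 1≤u u≤r = 1≤u , u≤r , +-monoˡ-< r (row-nonempty S _ 1≤u u≤r) , ≤-refl

  first-cell : ∀ {u} → 1 ≤ u → u ≤ r → InShape S (u , suc (mu S u + r))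
  first-cell 1≤u u≤r = 1≤u , u≤r , ≤-refl , +-monoˡ-< r (row-nonempty S _ 1≤u u≤r)

  column-cell : ∀ {v} → r < v → v ≤ r + c → ∃[ w ] InShape S (w , v)
  column-cell {v} r<v v≤r+c
    with col-nonempty S (v ∸ r) (m<n⇒0<n∸m r<v) (subst (v ∸ r ≤_) (m+n∸m≡n r c) (∸-monoˡ-≤ r v≤r+c))
  ... | w , 1≤w , w≤r , mu<k , k≤lam =
    w , 1≤w , w≤r , subst (mu S w + r <_) (m∸n+n≡m (<⇒≤ r<v)) (+-monoˡ-< r mu<k)
                  , subst (_≤ lam S w + r) (m∸n+n≡m (<⇒≤ r<v)) (+-monoˡ-≤ r k≤lam)

  lam-<⇒> : ∀ {a i} → 1 ≤ i → a ≤ r → lam S i < lam S a → a < i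
  lam-<⇒> 1≤i a≤r lam-i<lam-a = ≰⇒> λ i≤a → <⇒≱ lam-i<lam-a (lam-antitone 1≤i i≤a a≤r)

  no-column-gap : ∀ {u v} → suc u ≤ r → r < v → v ≤ r + c →
    mu S u + r < v ⊎ v ≤ lam S (suc u) + r
  no-column-gap {u} u<r r<v v≤r+c with column-cell r<v v≤r+c
  ... | w , 1≤w , w≤r , mu+r<v , v≤lam+r with w ≤? u
  ...   | yes w≤u = inj₁ (≤-<-trans (+-monoˡ-≤ r (mu-antitone 1≤w w≤u (<⇒≤ u<r))) mu+r<v)
  ...   | no  w≰u = inj₂ (≤-trans v≤lam+r (+-monoˡ-≤ r (lam-antitone (s≤s z≤n) (≰⇒> w≰u) w≤r)))

  RowReaches : ℕ → ℕ → Set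
  RowReaches a v = 1 ≤ a × a ≤ r × v ≤ lam S a + r

  InShape⇒RowReaches : ∀ {a v} → InShape S (a , v) → RowReaches a v
  InShape⇒RowReaches (1≤a , a≤r , _ , v≤lam+r) = 1≤a , a≤r , v≤lam+r

  RowReaches-upward : ∀ {a x v} → 1 ≤ a → a ≤ x → RowReaches x v → RowReaches a v
  RowReaches-upward 1≤a a≤x (_ , x≤r , v≤lam+r) =
    1≤a , ≤-trans a≤x x≤r , ≤-trans v≤lam+r (+-monoˡ-≤ r (lam-antitone 1≤a a≤x x≤r))

  RowReaches-left : ∀ {a v w} → w ≤ v → RowReaches a v → RowReaches a w
  RowReaches-left w≤v (1≤a , a≤r , v≤lam+r) = 1≤a , a≤r , ≤-trans w≤v v≤lam+r

  minL-RowReaches : ∀ {τ v} → All (InShape S) τ → Any (λ q → RowReaches (proj₁ q) v) τ →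
    RowReaches (minL (map proj₁ τ)) v
  minL-RowReaches τ-cells reaching with find reaching
  ... | (x , _) , x∈ , x-reaches with ∈.∈-map⁻ proj₁ (minL-∈ (∈.∈-map⁺ proj₁ x∈))
  ...   | (a , _) , a∈ , refl =
    RowReaches-upward (proj₁ (All.lookup τ-cells a∈)) (minL-≤ (∈.∈-map⁺ proj₁ x∈)) x-reaches

  row∈basis : ∀ {ρ u v} → InShape S (u , v) → Occupied proj₁ ρ u → InBasis r c ρ u
  row∈basis (1≤u , u≤r , _) occ = inj₁ (1≤u , u≤r , occ)

  row∉basis : ∀ {ρ u v} → InShape S (u , v) → ¬ Occupied proj₁ ρ u → ¬ InBasis r c ρ u
  row∉basis _             free (inj₁ (_ , _ , occ)) = free occ
  row∉basis (_ , u≤r , _) _    (inj₂ (r<u , _))     = <⇒≱ r<u u≤r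

  col∈basis : ∀ {ρ u v} → InShape S (u , v) → ¬ Occupied proj₂ ρ v → InBasis r c ρ v
  col∈basis cell free = inj₂ (InShape⇒r<col cell , InShape⇒col≤n cell , free)

  col∉basis : ∀ {ρ u v} → InShape S (u , v) → Occupied proj₂ ρ v → ¬ InBasis r c ρ v
  col∉basis cell _   (inj₁ (_ , v≤r , _)) = <⇒≱ (InShape⇒r<col cell) v≤r
  col∉basis _    occ (inj₂ (_ , _ , free)) = free occ

module Minimal {r c : ℕ} (S : SkewShape r c) {i : ℕ} (1≤i : 1 ≤ i) (i≤n : i ≤ r + c)
  {ρ : List Cell} (ρ-nonNesting : NonNesting S ρ)
  (ρ-minimal : ∀ σ → NonNesting S σ → LexLeqAt r c i ρ σ) where

  open Shape S
  open Rotation (r + c) i public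

  private
    ρ-cells : All (InShape S) ρ
    ρ-cells = proj₁ ρ-nonNesting
    ρ-compatible : AllPairs Compatible ρ
    ρ-compatible = proj₂ ρ-nonNesting

    improvable : ∀ {σ x y} → NonNesting S σ → y ≺ x →
      InBasis r c ρ x → ¬ InBasis r c ρ y → InBasis r c σ y →
      (∀ z → z ≢ x → z ≢ y → InBasis r c ρ z ⇔ InBasis r c σ z) → ⊥
    improvable σ-nonNesting y≺x ρx ¬ρy σy agree =
      ¬LexLeqAt-exchange 1≤i i≤n y≺x ρx ¬ρy σy agree (ρ-minimal _ σ-nonNesting)

    compatible-except : ∀ {p p′} → (∀ {q} → q ∈ ρ → q ≢ p → Compatible p′ q) →
      All (Compatible p′) (delete p ρ)
    compatible-except compat = All.tabulate λ q∈ → let q∈ρ , q≢p = ∈-delete⁻ q∈ in compat q∈ρ q≢p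

    replaced-nonNesting : ∀ {p p′} → InShape S p′ → (∀ {q} → q ∈ ρ → q ≢ p → Compatible p′ q) →
      NonNesting S (p′ ∷ delete p ρ)
    replaced-nonNesting cell′ compat =
      cell′ ∷ All.filter⁺ _ ρ-cells , compatible-except compat ∷ AllPairs.filter⁺ _ ρ-compatible

  ¬add : ∀ {u v} → InShape S (u , v) → All (Compatible (u , v)) ρ → ¬ (u ≺ v)
  ¬add cell compat u≺v = improvable (cell ∷ ρ-cells , compat ∷ ρ-compatible) u≺v
    (col∈basis cell (col-free compat)) (row∉basis cell (row-free compat)) (row∈basis cell (here refl))
    λ z z≢v z≢u → InBasis-cong (Occupied-∷ (≢-sym z≢u)) (Occupied-∷ (≢-sym z≢v))

  ¬remove : ∀ {t s} → (t , s) ∈ ρ → ¬ (s ≺ t)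
  ¬remove {t} {s} ts∈ρ s≺t = improvable (All.filter⁺ _ ρ-cells , AllPairs.filter⁺ _ ρ-compatible) s≺t
    (row∈basis cell (lose ts∈ρ refl)) (col∉basis cell (lose ts∈ρ refl))
    (col∈basis cell (col-free (compatible-with-others ρ-compatible ts∈ρ)))
    λ z z≢t z≢s → InBasis-cong (Occupied-delete (≢-sym z≢t)) (Occupied-delete (≢-sym z≢s))
    where
    cell : InShape S (t , s)
    cell = All.lookup ρ-cells ts∈ρ

  ¬moveRow : ∀ {a b a′} → (a , b) ∈ ρ → InShape S (a′ , b) →
    (∀ {q} → q ∈ ρ → q ≢ (a , b) → Compatible (a′ , b) q) → ¬ (a′ ≺ a)
  ¬moveRow {a} {b} {a′} ab∈ρ cell′ compat a′≺a = improvable (replaced-nonNesting cell′ compat) a′≺a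
    (row∈basis cell (lose ab∈ρ refl))
    (row∉basis cell′ (row-free (compatible-except compat) ∘ to (Occupied-delete a≢a′)))
    (row∈basis cell′ (here refl))
    λ z z≢a z≢a′ → InBasis-cong
      (Occupied-replace ab∈ρ (⇔-absurd (z≢a ∘ sym) (z≢a′ ∘ sym))) (Occupied-replace ab∈ρ ⇔.refl)
    where
    cell : InShape S (a , b)
    cell = All.lookup ρ-cells ab∈ρ
    a≢a′ : a ≢ a′
    a≢a′ refl = <-irrefl refl a′≺a

  ¬moveCol : ∀ {a b b′} → (a , b) ∈ ρ → InShape S (a , b′) →
    (∀ {q} → q ∈ ρ → q ≢ (a , b) → Compatible (a , b′) q) → ¬ (b ≺ b′)
  ¬moveCol {a} {b} {b′} ab∈ρ cell′ compat b≺b′ = improvable (replaced-nonNesting cell′ compat) b≺b′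
    (col∈basis cell′ (col-free (compatible-except compat) ∘ to (Occupied-delete b≢b′)))
    (col∉basis cell (lose ab∈ρ refl))
    (col∈basis cell λ { (here b′≡b) → b≢b′ (sym b′≡b)
                      ; (there occ) → col-free (compatible-with-others ρ-compatible ab∈ρ) occ })
    λ z z≢b′ z≢b → InBasis-cong
      (Occupied-replace ab∈ρ ⇔.refl) (Occupied-replace ab∈ρ (⇔-absurd (z≢b ∘ sym) (z≢b′ ∘ sym)))
    where
    cell : InShape S (a , b)
    cell = All.lookup ρ-cells ab∈ρ
    b≢b′ : b ≢ b′
    b≢b′ refl = <-irrefl refl b≺b′

module Necklace {r c : ℕ} (S : SkewShape r c) {ρ : ℕ → List Cell}
  (ρ-necklace : IsNecklacePlacements S ρ) where

  open Shape S

  module Minimalᵢ {i} (1≤i : 1 ≤ i) (i≤n : i ≤ r + c) =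
    Minimal S 1≤i i≤n (proj₁ (ρ-necklace i 1≤i i≤n)) (proj₂ (ρ-necklace i 1≤i i≤n))

  all-cells : ∀ {i} → 1 ≤ i → i ≤ r + c → All (InShape S) (ρ i)
  all-cells 1≤i i≤n = proj₁ (proj₁ (ρ-necklace _ 1≤i i≤n))

  cells : ∀ {i} → 1 ≤ i → i ≤ r + c → ∀ {p} → p ∈ ρ i → InShape S p
  cells 1≤i i≤n = All.lookup (all-cells 1≤i i≤n)

  compatible : ∀ {i} → 1 ≤ i → i ≤ r + c → ∀ {p q} → p ∈ ρ i → q ∈ ρ i → p ≢ q → Compatible p q
  compatible 1≤i i≤n = compatible-∈ (proj₂ (proj₁ (ρ-necklace _ 1≤i i≤n)))

  i≤r⇒i≤n : ∀ {i} → i ≤ r → i ≤ r + c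
  i≤r⇒i≤n i≤r = ≤-trans i≤r (m≤m+n r c)

  rooks-weakly-below : ∀ {i} → 1 ≤ i → i ≤ r → ∀ {t s} → (t , s) ∈ ρ i → i ≤ t
  rooks-weakly-below 1≤i i≤r {t} {s} ts∈ = ≮⇒≥ λ t<i →
    ¬remove ts∈
      (≺-wrap (≤-trans i≤r (<⇒≤ (InShape⇒r<col cell))) (InShape⇒col≤n cell) (proj₁ cell) t<i)
    where
    open Minimalᵢ 1≤i (i≤r⇒i≤n i≤r)
    cell : InShape S (t , s)
    cell = cells 1≤i (i≤r⇒i≤n i≤r) ts∈

  row-end-compatible : ∀ {i} → 1 ≤ i → i ≤ r → (∀ {p} → p ∈ ρ i → proj₂ p < lam S i + r) →
    ∀ {q} → q ∈ ρ i → proj₁ q ≢ i → Compatible (i , lam S i + r) q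
  row-end-compatible 1≤i i≤r before-end q∈ x≢i =
    Compatible-antidiagonal (≤∧≢⇒< (rooks-weakly-below 1≤i i≤r q∈) (≢-sym x≢i)) (before-end q∈)

  ¬all-before-row-end : ∀ {i} → 1 ≤ i → i ≤ r →
    ¬ (∀ {p} → p ∈ ρ i → proj₂ p < lam S i + r)
  ¬all-before-row-end {i} 1≤i i≤r before-end with any? (λ p → proj₁ p ≟ i) (ρ i)
  ... | yes in-row-i = move-to-end (find in-row-i)
    where
    i≤n : i ≤ r + c
    i≤n = i≤r⇒i≤n i≤r
    open Minimalᵢ 1≤i i≤n
    move-to-end : ∃[ p ] (p ∈ ρ i × proj₁ p ≡ i) → ⊥
    move-to-end ((_ , b) , ib∈ , refl) = ¬moveCol ib∈ (last-cell 1≤i i≤r)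
      (λ q∈ q≢ib → row-end-compatible 1≤i i≤r before-end q∈
                     (≢-sym (proj₁ (compatible 1≤i i≤n ib∈ q∈ (≢-sym q≢ib)))))
      (<⇒≺-≥i (≤-trans i≤r (<⇒≤ (InShape⇒r<col (cells 1≤i i≤n ib∈)))) (before-end ib∈))
  ... | no ¬in-row-i = ¬add (last-cell 1≤i i≤r)
      (All.tabulate λ q∈ → row-end-compatible 1≤i i≤r before-end q∈ (¬in-row-i ∘ lose q∈))
      (<⇒≺-≥i ≤-refl (≤-<-trans i≤r (InShape⇒r<col (last-cell 1≤i i≤r))))
    where open Minimalᵢ 1≤i (i≤r⇒i≤n i≤r)

  row-end≤cIdx : ∀ {i} → 1 ≤ i → i ≤ r → lam S i + r ≤ cIdx ρ i
  row-end≤cIdx {i} 1≤i i≤r = maxL-≥ (Any.map⁺ reaches-end)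
    where
    reaches-end : Any (λ p → lam S i + r ≤ proj₂ p) (ρ i)
    reaches-end = decidable-stable (any? (λ p → lam S i + r ≤? proj₂ p) (ρ i)) λ ¬reached →
      ¬all-before-row-end 1≤i i≤r λ p∈ → ≰⇒> (¬reached ∘ lose p∈)

  rIdx-≤n : ∀ {j} → j ≤ r + c → rIdx r c ρ j ≡ minL (map proj₁ (ρ j))
  rIdx-≤n {j} j≤n with r + c <ᵇ j | <ᵇ-reflects-< (r + c) j
  ... | false | _        = refl
  ... | true  | ofʸ n<j = contradiction j≤n (<⇒≱ n<j)

  rIdx->n : ∀ {j} → r + c < j → rIdx r c ρ j ≡ 0
  rIdx->n {j} n<j with r + c <ᵇ j | <ᵇ-reflects-< (r + c) j
  ... | true  | _         = refl
  ... | false | ofⁿ n≮j = contradiction n<j n≮j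

  rIdx-RowReaches : ∀ {v} → r < v → suc v ≤ r + c → RowReaches (rIdx r c ρ (suc v)) v
  rIdx-RowReaches {v} r<v v<n rewrite rIdx-≤n v<n with column-cell r<v (<⇒≤ v<n)
  ... | w , cell@(_ , w≤r , _) = minL-RowReaches (all-cells (s≤s z≤n) v<n) (reaching (find blocked))
    where
    open Minimalᵢ (s≤s z≤n) v<n
    ¬unblocked : ¬ ¬ Any (λ (x , y) → x ≤ w ⊎ v ≤ y) (ρ (suc v))
    ¬unblocked ¬blocked = ¬add cell
      (All.map (λ ¬b → Compatible-antidiagonal (≰⇒> (¬b ∘ inj₁)) (≰⇒> (¬b ∘ inj₂)))
               (All.¬Any⇒All¬ _ ¬blocked))
      (<⇒≺-<i v<n (≤-<-trans w≤r r<v) ≤-refl)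
    blocked : Any (λ (x , y) → x ≤ w ⊎ v ≤ y) (ρ (suc v))
    blocked = decidable-stable (any? (λ (x , y) → (x ≤? w) ⊎-dec (v ≤? y)) (ρ (suc v))) ¬unblocked
    reaching : ∃[ q ] (q ∈ ρ (suc v) × (proj₁ q ≤ w ⊎ v ≤ proj₂ q)) →
      Any (λ q → RowReaches (proj₁ q) v) (ρ (suc v))
    reaching ((x , y) , xy∈ , x≤w⊎v≤y) = lose xy∈
      ([ (λ x≤w → RowReaches-upward (proj₁ xy-cell) x≤w (InShape⇒RowReaches cell)) ,
         (λ v≤y → RowReaches-left v≤y (InShape⇒RowReaches xy-cell)) ] x≤w⊎v≤y)
      where
      xy-cell : InShape S (x , y)
      xy-cell = cells (s≤s z≤n) v<n xy∈

  j∸1≤cIdx[rIdx[j]] : (j : ℕ) → r + 2 ≤ j → j ≤ r + c → j ∸ 1 ≤ cIdx ρ (rIdx r c ρ j)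
  j∸1≤cIdx[rIdx[j]] j r+2≤j j≤n with subst (_≤ j) (+-comm r 2) r+2≤j
  ... | s≤s r<v with rIdx-RowReaches r<v j≤n
  ...   | 1≤a , a≤r , v≤end = ≤-trans v≤end (row-end≤cIdx 1≤a a≤r)

  rIdx[cIdx[i]+2]∸1≤i : (i : ℕ) → 1 ≤ i → i ≤ r → rIdx r c ρ (cIdx ρ i + 2) ∸ 1 ≤ i
  rIdx[cIdx[i]+2]∸1≤i i 1≤i i≤r rewrite +-comm (cIdx ρ i) 2 with r + c <? suc (suc (cIdx ρ i))
  ... | yes n<j rewrite rIdx->n n<j = z≤n
  ... | no  n≮j with rIdx-RowReaches
                      (m<n⇒m<1+n (<-≤-trans (InShape⇒r<col (last-cell 1≤i i≤r)) (row-end≤cIdx 1≤i i≤r)))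
                      (≮⇒≥ n≮j)
  ...   | 1≤a , a≤r , 1+C≤end = ≤-trans (m∸n≤m _ 1) (<⇒≤ (lam-<⇒> 1≤i a≤r
          (+-cancelʳ-< r _ _ (<-≤-trans (s≤s (row-end≤cIdx 1≤i i≤r)) 1+C≤end))))

  -- The rooks are (t , s₁ + 1) and (u + 1 , s′), so row u and column s₁ lie strictly between.
  module Gap {i} (1≤i : 1 ≤ i) (i≤n : i ≤ r + c) {t s₁ u s′ : ℕ}
    (ts∈ : (t , suc s₁) ∈ ρ i) (t′s′∈ : (suc u , s′) ∈ ρ i) (t<u : t < u) (s′<s₁ : s′ < s₁)
    (nothing-between : ∀ x y → (x , y) ∈ ρ i → ¬ (t < x × x < suc u)) where

    open Minimalᵢ 1≤i i≤n

    private
      cell-ts : InShape S (t , suc s₁)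
      cell-ts = cells 1≤i i≤n ts∈
      cell-t′s′ : InShape S (suc u , s′)
      cell-t′s′ = cells 1≤i i≤n t′s′∈
      1≤t : 1 ≤ t
      1≤t = proj₁ cell-ts
      t≤r : t ≤ r
      t≤r = proj₁ (proj₂ cell-ts)
      t′≤r : suc u ≤ r
      t′≤r = proj₁ (proj₂ cell-t′s′)
      start-t′<s′ : mu S (suc u) + r < s′
      start-t′<s′ = proj₁ (proj₂ (proj₂ cell-t′s′))
      s′≤end-t′ : s′ ≤ lam S (suc u) + r
      s′≤end-t′ = proj₂ (proj₂ (proj₂ cell-t′s′))
      u≤r : u ≤ r
      u≤r = ≤-trans (n≤1+n u) t′≤r
      1≤u : 1 ≤ u
      1≤u = ≤-trans (s≤s z≤n) t<u
      r<s′ : r < s′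
      r<s′ = InShape⇒r<col cell-t′s′
      r<s₁ : r < s₁
      r<s₁ = <-trans r<s′ s′<s₁

    separated : ∀ {x y} → (x , y) ∈ ρ i → (x , y) ≢ (t , suc s₁) → (x , y) ≢ (suc u , s′) →
      (x < t × suc s₁ < y) ⊎ (suc u < x × y < s′)
    separated {x} {y} xy∈ xy≢ts xy≢t′s′ with x <? t
    ... | yes x<t = inj₁ (x<t , Compatible⇒antidiagonal compat-ts x<t)
      where
      compat-ts : Compatible (x , y) (t , suc s₁)
      compat-ts = compatible 1≤i i≤n xy∈ ts∈ xy≢ts
    ... | no  x≮t = inj₂ (t′<x , Compatible⇒antidiagonal (Compatible-sym compat-t′s′) t′<x)
      where
      compat-t′s′ : Compatible (x , y) (suc u , s′)
      compat-t′s′ = compatible 1≤i i≤n xy∈ t′s′∈ xy≢t′s′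
      t<x : t < x
      t<x = ≤∧≢⇒< (≮⇒≥ x≮t) (≢-sym (proj₁ (compatible 1≤i i≤n xy∈ ts∈ xy≢ts)))
      t′<x : suc u < x
      t′<x = ≤∧≢⇒< (≮⇒≥ λ x<t′ → nothing-between x y xy∈ (t<x , x<t′)) (≢-sym (proj₁ compat-t′s′))

    compatible-in-gap : ∀ {a b} → t < a → a ≤ suc u → s′ ≤ b → b < suc s₁ →
      ∀ {q} → q ∈ ρ i → q ≢ (suc u , s′) → Compatible (a , b) q
    compatible-in-gap t<a a≤t′ s′≤b b<s {x , y} q∈ q≢t′s′ with (x , y) ≟ᶜ (t , suc s₁)
    ... | yes refl = Compatible-sym (Compatible-antidiagonal t<a b<s)
    ... | no q≢ts with separated q∈ q≢ts q≢t′s′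
    ...   | inj₁ (x<t , s<y)   =
      Compatible-sym (Compatible-antidiagonal (<-trans x<t t<a) (<-trans b<s s<y))
    ...   | inj₂ (t′<x , y<s′) =
      Compatible-antidiagonal (≤-<-trans a≤t′ t′<x) (<-≤-trans y<s′ s′≤b)

    ¬gap-ordered : (∀ {x y} → t ≤ x → x < y → y ≤ suc s₁ → x ≺ y) → ⊥
    ¬gap-ordered ordered with no-column-gap t′≤r r<s₁ (≤-trans (n≤1+n s₁) (InShape⇒col≤n cell-ts))
    ... | inj₂ s₁≤end = ¬moveCol t′s′∈ shifted
          (compatible-in-gap (<-trans t<u (n<1+n u)) ≤-refl (n≤1+n s′) (s≤s s′<s₁))
          (ordered (≤-trans t≤r (<⇒≤ r<s′)) ≤-refl (s≤s (<⇒≤ s′<s₁)))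
      where
      shifted : InShape S (suc u , suc s′)
      shifted = s≤s z≤n , t′≤r , m<n⇒m<1+n start-t′<s′ , <-≤-trans s′<s₁ s₁≤end
    ... | inj₁ start<s₁ with mu S u + r <? s′
    ...   | yes start<s′ = ¬moveRow t′s′∈ raised
          (compatible-in-gap t<u (n≤1+n u) ≤-refl (m<n⇒m<1+n s′<s₁))
          (ordered (<⇒≤ t<u) ≤-refl (≤-trans t′≤r (≤-trans (<⇒≤ r<s₁) (n≤1+n s₁))))
      where
      raised : InShape S (u , s′)
      raised = 1≤u , u≤r , start<s′ ,
        ≤-trans s′≤end-t′ (+-monoˡ-≤ r (lam-antitone 1≤u (n≤1+n u) t′≤r))
    ...   | no  start≮s′ = ¬add (first-cell 1≤u u≤r) (All.tabulate compat)
          (ordered (<⇒≤ t<u) (s≤s (≤-trans u≤r (m≤n+m r _))) (m≤n⇒m≤1+n start<s₁))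
      where
      compat : ∀ {q} → q ∈ ρ i → Compatible (u , suc (mu S u + r)) q
      compat {q} q∈ with q ≟ᶜ (suc u , s′)
      ... | yes refl    = Compatible-antidiagonal (n<1+n u) (s≤s (≮⇒≥ start≮s′))
      ... | no q≢t′s′ =
        compatible-in-gap t<u (n≤1+n u) (m≤n⇒m≤1+n (≮⇒≥ start≮s′)) (s≤s start<s₁) q∈ q≢t′s′

    ¬gap : ⊥
    ¬gap with t <? i | i ≤? suc s₁
    ... | yes t<i | yes i≤s = ¬remove ts∈ (≺-wrap i≤s (InShape⇒col≤n cell-ts) 1≤t t<i)
    ... | yes _   | no  i≰s = ¬gap-ordered λ _ x<y y≤s → <⇒≺-<i i≤n x<y (≤-<-trans y≤s (≰⇒> i≰s))
    ... | no  t≮i | _       = ¬gap-ordered λ t≤x x<y _ → <⇒≺-≥i (≤-trans (≮⇒≥ t≮i) t≤x) x<y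

  no-double-gap : ∀ {i} → 1 ≤ i → i ≤ r + c → ∀ {t s t′ s′} → (t , s) ∈ ρ i → (t′ , s′) ∈ ρ i →
    (∀ x y → (x , y) ∈ ρ i → ¬ (t < x × x < t′)) → suc t < t′ → suc s′ < s → ⊥
  no-double-gap 1≤i i≤n {s = suc s₁} {t′ = suc u} ts∈ t′s′∈ nothing-between (s≤s t<u) (s≤s s′<s₁) =
    Gap.¬gap 1≤i i≤n ts∈ t′s′∈ t<u s′<s₁ nothing-between

  consecutive-rooks : (i : ℕ) → 1 ≤ i → i ≤ r + c →
    (t s t′ s′ : ℕ) → (t , s) ∈ ρ i → (t′ , s′) ∈ ρ i → t < t′ →
    (∀ u v → (u , v) ∈ ρ i → ¬ (t < u × u < t′)) →
    (t′ ≡ t + 1 ⊎ s′ ≡ s ∸ 1)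
  consecutive-rooks i 1≤i i≤n t s t′ s′ ts∈ t′s′∈ t<t′ nothing-between with t′ ≟ t + 1 | s′ ≟ s ∸ 1
  ... | yes t′≡t+1 | _          = inj₁ t′≡t+1
  ... | no _       | yes s′≡s-1 = inj₂ s′≡s-1
  ... | no t′≢t+1  | no s′≢s-1  = ⊥-elim (no-double-gap 1≤i i≤n ts∈ t′s′∈ nothing-between
          (≤∧≢⇒< t<t′ λ 1+t≡t′ → t′≢t+1 (trans (sym 1+t≡t′) (+-comm 1 t)))
          (≤∧≢⇒< s′<s λ 1+s′≡s → s′≢s-1 (cong (_∸ 1) 1+s′≡s)))
    where
    s′<s : s′ < s
    s′<s = Compatible⇒antidiagonal (compatible 1≤i i≤n ts∈ t′s′∈ (<⇒≢ t<t′ ∘ cong proj₁)) t<t′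

lemma3p29 : (r c : ℕ) (S : SkewShape r c) (ρ : ℕ → List Cell) →
    IsNecklacePlacements S ρ →
    ((j : ℕ) → r + 2 ≤ j → j ≤ r + c →
        j ∸ 1 ≤ cIdx ρ (rIdx r c ρ j))
    × ((i : ℕ) → 1 ≤ i → i ≤ r →
        rIdx r c ρ (cIdx ρ i + 2) ∸ 1 ≤ i)
    × ((i : ℕ) → 1 ≤ i → i ≤ r + c →
        (t s t′ s′ : ℕ) → (t , s) ∈ ρ i → (t′ , s′) ∈ ρ i → t < t′ →
        (∀ u v → (u , v) ∈ ρ i → ¬ (t < u × u < t′)) →
        (t′ ≡ t + 1 ⊎ s′ ≡ s ∸ 1))
lemma3p29 r c S ρ necklace = j∸1≤cIdx[rIdx[j]] , rIdx[cIdx[i]+2]∸1≤i , consecutive-rooks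
  where open Necklace S necklace
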